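{- Let $n\ge 2$ be an integer and $\zeta_n=e^{2\pi i/n}$. For $1\le m\le\lfloor n/2\rfloor-1$, $$\mathfrak Z_n^\star(\zeta_n;m,2)=-\sum_{j=0}^{m-1}\frac{1}{n^2}\left(2\binom{n}{2m-2j+2}+(-1)^{m-j}\binom{n}{m-j+1}\right)\mathfrak Z_n^\star(\zeta_n;j,2),$$ with the convention $\mathfrak Z_n^\star(\zeta_n;0,2)=1$.
   Context: For positive integers $n,m,s$ and $q$ with $q^i\ne1$ for $1\le i\le n-1$, define $\mathfrak Z_n^\star(q;m,s)=\sum_{1\le i_1\le i_2\le\dots\le i_m\le n-1}\prod_{k=1}^m(1-q^{i_k})^{ -s}$. -}

module Defs where

open import Level using (Level; _⊔_)
open import Algebra.Bundles using (CommutativeRing; Semiring)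
import Algebra.Definitions.RawSemiring as RS
open import Data.Nat using (ℕ; zero; suc; _∸_; _≤?_)
open import Data.List using (List; []; _∷_; map; filter; concatMap; upTo; foldr)
open import Relation.Nullary using (¬_)

record CharZeroField (c ℓ : Level) : Set (Level.suc (c ⊔ ℓ)) where
  field
    commRing : CommutativeRing c ℓ
    inv       : CommutativeRing.Carrier commRing → CommutativeRing.Carrier commRing
    inv-right : let open CommutativeRing commRing in
                ∀ x → ¬ (x ≈ 0#) → x * inv x ≈ 1#
    char-zero : let open CommutativeRing commRing in
                ∀ k → ¬ (RS._×_ (Semiring.rawSemiring semiring) (suc k) 1# ≈ 0#)
  open CommutativeRing commRing public
  open RS (Semiring.rawSemiring semiring) public using (_×_; _^_)

  ι : ℕ → Carrier
  ι k = k × 1#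

  Σ : List Carrier → Carrier
  Σ = foldr _+_ 0#

  Π : List Carrier → Carrier
  Π = foldr _*_ 1#

range1 : ℕ → List ℕ
range1 n = map suc (upTo (n ∸ 1))

-- all non-decreasing sequences lo ≤ i₁ ≤ i₂ ≤ … ≤ i_m ≤ n-1 with entries ≥ 1
nondecSeqs : (n lo m : ℕ) → List (List ℕ)
nondecSeqs n lo zero    = [] ∷ []
nondecSeqs n lo (suc m) =
  concatMap (λ i → map (i ∷_) (nondecSeqs n i m)) (filter (lo ≤?_) (range1 n))

module _ {c ℓ} (F : CharZeroField c ℓ) where
  open CharZeroField F

  Zstar : (n : ℕ) → Carrier → (m s : ℕ) → Carrier
  Zstar n q m s =
    Σ (map (λ is → Π (map (λ i → inv (1# - q ^ i) ^ s) is)) (nondecSeqs n 1 m))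

-- Put xᵢ = (1 - ζⁱ)⁻² for 0 < i < n and X = ∏ xᵢ. Then 𝔷*ₙ(ζ; m, 2) is the complete
-- homogeneous symmetric polynomial hₘ(x₁, …, xₙ₋₁), and Σ hₘ tᵐ · ∏ (1 - xᵢ t) = 1 gives
-- hₘ = -Σ_{j<m} hⱼ eₘ₋ⱼ, where eₖ is the coefficient of tᵏ in ∏ (1 - xᵢ t). Since
-- 1 - xᵢ s² = xᵢ (1 - s - ζⁱ)(1 + s - ζⁱ) and ∏_{0<i<n} (x - ζⁱ) = (xⁿ - 1)/(x - 1),
--   s² ∏ (1 - xᵢ s²) = -X (1 - (1 - s)ⁿ - (1 + s)ⁿ + (1 - s²)ⁿ).
-- Both sides are polynomials in s, and over a field of characteristic zero they agree
-- coefficientwise; at s^(2k+2) this reads eₖ = X (2 C(n, 2k+2) + (-1)ᵏ C(n, k+1)), and k = 0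
-- gives X = 1/n².
module Submission where

open import Defs
open import Data.Nat using (ℕ; _≤_; _<_; _∸_; _/_)
import Data.Nat as N
open import Data.Nat.Combinatorics using (_C_)
open import Data.List using (map; upTo)
open import Relation.Nullary using (¬_)

open import Level using (_⊔_)
open import Function using (id)
open import Algebra.Bundles using (CommutativeRing)
import Algebra.Solver.Ring.AlmostCommutativeRing as ACR
open import Data.Empty using (⊥-elim)
open import Data.Sum using (inj₁; inj₂)
open import Data.Maybe using (Maybe; just; nothing)
open import Data.Nat using (zero; suc; z≤n; s≤s; _≤?_)
import Data.Nat.Properties as ℕP
open import Data.Nat.Combinatorics using (nCk+nC[k+1]≡[n+1]C[k+1]; nC1≡n)
open import Data.Integer as ℤ using (ℤ; +_; -[1+_]; _⊖_)
import Data.Integer.Properties as ℤP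
import Data.Sign as Sign
open import Data.List using (List; []; _∷_; length; applyUpTo; filter; concatMap; _++_)
import Data.List.Properties as LP
open import Data.List.Relation.Unary.All as All using (All; []; _∷_)
open import Data.List.Relation.Unary.All.Properties using (applyUpTo⁺₁; map⁺)
open import Data.List.Relation.Unary.Any using (here; there)
open import Data.List.Membership.Propositional using (_∈_)
open import Data.List.Membership.Propositional.Properties using (∈-applyUpTo⁺; ∈-map⁺; ∈-upTo⁺)
open import Relation.Nullary using (yes; no)
open import Relation.Binary.PropositionalEquality as ≡ using (_≡_)

-- The tail-call-optimised _×_ makes fromℤ (+ 1) reduce to 1#, so that
-- the constants con (+ 0) and con (+ 1) of a solver expression match 0# and 1# in goals.
module ℤ-Solver {c ℓ} (R : CommutativeRing c ℓ) where
  open CommutativeRing R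
  open import Algebra.Properties.Ring ring
  open import Algebra.Properties.Semiring.Mult.TCOptimised semiring
  open import Relation.Binary.Reasoning.Setoid setoid

  fromℤ : ℤ → Carrier
  fromℤ (+ n)    = n × 1#
  fromℤ -[1+ n ] = - (suc n × 1#)

  ×1-∸ : ∀ m n → n N.≤ m → (m ∸ n) × 1# ≈ m × 1# - n × 1#
  ×1-∸ m n n≤m = begin
    (m ∸ n) × 1#                         ≈⟨ +-identityʳ _ ⟨
    (m ∸ n) × 1# + 0#                    ≈⟨ +-congˡ (-‿inverseʳ (n × 1#)) ⟨
    (m ∸ n) × 1# + (n × 1# - n × 1#)     ≈⟨ +-assoc _ _ _ ⟨
    ((m ∸ n) × 1# + n × 1#) - n × 1#     ≈⟨ +-congʳ (×-homo-+ 1# (m ∸ n) n) ⟨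
    ((m ∸ n) N.+ n) × 1# - n × 1#        ≡⟨ ≡.cong (λ k → k × 1# - n × 1#) (ℕP.m∸n+n≡m n≤m) ⟩
    m × 1# - n × 1#                      ∎

  fromℤ-neg : ∀ i → fromℤ (ℤ.- i) ≈ - fromℤ i
  fromℤ-neg (+ zero)  = sym -0#≈0#
  fromℤ-neg (+ suc n) = refl
  fromℤ-neg -[1+ n ]  = sym (-‿involutive _)

  fromℤ-⊖ : ∀ m n → fromℤ (m ⊖ n) ≈ m × 1# - n × 1#
  fromℤ-⊖ m n with ℕP.≤-<-connex n m
  ... | inj₁ n≤m = begin
    fromℤ (m ⊖ n)          ≡⟨ ≡.cong fromℤ (ℤP.⊖-≥ n≤m) ⟩
    (m ∸ n) × 1#           ≈⟨ ×1-∸ m n n≤m ⟩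
    m × 1# - n × 1#        ∎
  ... | inj₂ m<n = begin
    fromℤ (m ⊖ n)                  ≡⟨ ≡.cong fromℤ (ℤP.⊖-< m<n) ⟩
    fromℤ (ℤ.- (+ (n ∸ m)))        ≈⟨ fromℤ-neg (+ (n ∸ m)) ⟩
    - ((n ∸ m) × 1#)               ≈⟨ -‿cong (×1-∸ n m (ℕP.<⇒≤ m<n)) ⟩
    - (n × 1# - m × 1#)            ≈⟨ -‿anti-homo-+ _ _ ⟩
    - - (m × 1#) - n × 1#          ≈⟨ +-congʳ (-‿involutive _) ⟩
    m × 1# - n × 1#                ∎

  fromℤ-+ : ∀ i j → fromℤ (i ℤ.+ j) ≈ fromℤ i + fromℤ j
  fromℤ-+ (+ m)    (+ n)    = ×-homo-+ 1# m n
  fromℤ-+ (+ m)    -[1+ n ] = fromℤ-⊖ m (suc n)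
  fromℤ-+ -[1+ m ] (+ n)    = trans (fromℤ-⊖ n (suc m)) (+-comm _ _)
  fromℤ-+ -[1+ m ] -[1+ n ] = begin
    - (suc (suc (m N.+ n)) × 1#)      ≡⟨ ≡.cong (λ k → - (k × 1#)) (ℕP.+-suc (suc m) n) ⟨
    - ((suc m N.+ suc n) × 1#)        ≈⟨ -‿cong (×-homo-+ 1# (suc m) (suc n)) ⟩
    - (suc m × 1# + suc n × 1#)       ≈⟨ -‿+-comm _ _ ⟨
    - (suc m × 1#) + - (suc n × 1#)   ∎

  fromℤ-◃ : ∀ s k → fromℤ (s ℤ.◃ k) ≈ fromℤ (s ℤ.◃ 1) * (k × 1#)
  fromℤ-◃ Sign.+ zero    = sym (zeroʳ _)
  fromℤ-◃ Sign.+ (suc k) = sym (*-identityˡ _)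
  fromℤ-◃ Sign.- zero    = sym (zeroʳ _)
  fromℤ-◃ Sign.- (suc k) = trans (-‿cong (sym (*-identityˡ _))) (-‿distribˡ-* _ _)

  fromℤ-* : ∀ i j → fromℤ (i ℤ.* j) ≈ fromℤ i * fromℤ j
  fromℤ-* (+ m)    (+ n)    = trans (fromℤ-◃ Sign.+ (m N.* n)) (trans (*-identityˡ _) (×1-homo-* m n))
  fromℤ-* (+ m)    -[1+ n ] = begin
    fromℤ (Sign.- ℤ.◃ (m N.* suc n))   ≈⟨ fromℤ-◃ Sign.- (m N.* suc n) ⟩
    - 1# * ((m N.* suc n) × 1#)         ≈⟨ *-congˡ (×1-homo-* m (suc n)) ⟩
    - 1# * (m × 1# * suc n × 1#)        ≈⟨ -1*x≈-x _ ⟩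
    - (m × 1# * suc n × 1#)             ≈⟨ -‿distribʳ-* _ _ ⟩
    m × 1# * - (suc n × 1#)             ∎
  fromℤ-* -[1+ m ] (+ n)    = begin
    fromℤ (Sign.- ℤ.◃ (suc m N.* n))   ≈⟨ fromℤ-◃ Sign.- (suc m N.* n) ⟩
    - 1# * ((suc m N.* n) × 1#)         ≈⟨ *-congˡ (×1-homo-* (suc m) n) ⟩
    - 1# * (suc m × 1# * n × 1#)        ≈⟨ -1*x≈-x _ ⟩
    - (suc m × 1# * n × 1#)             ≈⟨ -‿distribˡ-* _ _ ⟩
    - (suc m × 1#) * n × 1#             ∎
  fromℤ-* -[1+ m ] -[1+ n ] = begin
    (suc m N.* suc n) × 1#              ≈⟨ ×1-homo-* (suc m) (suc n) ⟩
    suc m × 1# * suc n × 1#             ≈⟨ -‿involutive _ ⟨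
    - - (suc m × 1# * suc n × 1#)       ≈⟨ -‿cong (-‿distribˡ-* _ _) ⟩
    - (- (suc m × 1#) * suc n × 1#)     ≈⟨ -‿distribʳ-* _ _ ⟩
    - (suc m × 1#) * - (suc n × 1#)     ∎

  fromℤ-homomorphism : ℤ.+-*-rawRing ACR.-Raw-AlmostCommutative⟶ ACR.fromCommutativeRing R
  fromℤ-homomorphism = record
    { ⟦_⟧    = fromℤ
    ; +-homo = fromℤ-+
    ; *-homo = fromℤ-*
    ; -‿homo = fromℤ-neg
    ; 0-homo = refl
    ; 1-homo = refl
    }

  fromℤ-≟ : ∀ i j → Maybe (fromℤ i ≈ fromℤ j)
  fromℤ-≟ i j with i ℤ.≟ j
  ... | yes ≡.refl = just refl
  ... | no _       = nothing

  open import Algebra.Solver.Ring ℤ.+-*-rawRing (ACR.fromCommutativeRing R) fromℤ-homomorphism fromℤ-≟ public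

interval : ℕ → ℕ → List ℕ
interval a zero    = []
interval a (suc k) = a ∷ interval (suc a) k

applyUpTo≡interval : ∀ (f : ℕ → ℕ) a k → (∀ i → f i ≡ a N.+ i) → applyUpTo f k ≡ interval a k
applyUpTo≡interval f a zero    f≡a+ = ≡.refl
applyUpTo≡interval f a (suc k) f≡a+ = ≡.cong₂ _∷_ (≡.trans (f≡a+ 0) (ℕP.+-identityʳ a))
  (applyUpTo≡interval (λ i → f (suc i)) (suc a) k (λ i → ≡.trans (f≡a+ (suc i)) (ℕP.+-suc a i)))

range1≡interval : ∀ n → range1 n ≡ interval 1 (n ∸ 1)
range1≡interval n = ≡.trans (LP.map-applyUpTo id suc (n ∸ 1)) (applyUpTo≡interval suc 1 (n ∸ 1) (λ _ → ≡.refl))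

filter-≤-interval : ∀ lo a k → lo ≤ a → filter (lo ≤?_) (interval a k) ≡ interval a k
filter-≤-interval lo a zero    _    = ≡.refl
filter-≤-interval lo a (suc k) lo≤a = ≡.trans (LP.filter-accept (lo ≤?_) lo≤a)
  (≡.cong (a ∷_) (filter-≤-interval lo (suc a) k (ℕP.m≤n⇒m≤1+n lo≤a)))

filter-interval : ∀ a k′ lo k → a ≤ lo → lo N.+ k ≡ a N.+ k′ → filter (lo ≤?_) (interval a k′) ≡ interval lo k
filter-interval a k′ lo k a≤lo eq with a N.≟ lo
... | yes ≡.refl =
  ≡.trans (filter-≤-interval a a k′ ℕP.≤-refl) (≡.cong (interval a) (ℕP.+-cancelˡ-≡ a k′ k (≡.sym eq)))
filter-interval a zero      lo k a≤lo eq | no a≢lo = ⊥-elim (ℕP.<⇒≱ (ℕP.≤∧≢⇒< a≤lo a≢lo)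
  (ℕP.≤-trans (ℕP.m≤m+n lo k) (ℕP.≤-reflexive (≡.trans eq (ℕP.+-identityʳ a)))))
filter-interval a (suc k′) lo k a≤lo eq | no a≢lo = ≡.trans
  (LP.filter-reject (lo ≤?_) (λ lo≤a → a≢lo (ℕP.≤-antisym a≤lo lo≤a)))
  (filter-interval (suc a) k′ lo k (ℕP.≤∧≢⇒< a≤lo a≢lo) (≡.trans eq (ℕP.+-suc a k′)))

double : ℕ → ℕ
double zero    = zero
double (suc k) = suc (suc (double k))

double-suc : ∀ k → double (suc k) ≡ 2 N.* k N.+ 2
double-suc zero    = ≡.refl
double-suc (suc k) = ≡.trans (≡.cong (λ m → suc (suc m)) (double-suc k))
                             (≡.cong (N._+ 2) (≡.sym (ℕP.+-suc (suc k) (k N.+ 0))))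

double-mono-< : ∀ {a b} → a < b → double a < double b
double-mono-< {zero}  {suc b} _         = s≤s z≤n
double-mono-< {suc a} {suc b} (s≤s a<b) = s≤s (s≤s (double-mono-< a<b))

n≤double : ∀ a → a ≤ double a
n≤double zero    = z≤n
n≤double (suc a) = s≤s (ℕP.m≤n⇒m≤1+n (n≤double a))

2*nC2+n≡n*n : ∀ n → 2 N.* (n C 2) N.+ n ≡ n N.* n
2*nC2+n≡n*n zero    = ≡.refl
2*nC2+n≡n*n (suc n) = begin
  2 N.* (suc n C 2) N.+ suc n
    ≡⟨ ≡.cong (λ v → 2 N.* v N.+ suc n) (nCk+nC[k+1]≡[n+1]C[k+1] n 1) ⟨
  2 N.* (n C 1 N.+ n C 2) N.+ suc n
    ≡⟨ ≡.cong (λ v → 2 N.* (v N.+ n C 2) N.+ suc n) (nC1≡n n) ⟩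
  2 N.* (n N.+ n C 2) N.+ suc n
    ≡⟨ regroup n (n C 2) ⟩
  (2 N.* (n C 2) N.+ n) N.+ suc (n N.+ n)
    ≡⟨ ≡.cong (N._+ suc (n N.+ n)) (2*nC2+n≡n*n n) ⟩
  n N.* n N.+ suc (n N.+ n)
    ≡⟨ square-suc n ⟩
  suc n N.* suc n ∎
  where
  open ≡.≡-Reasoning
  open import Data.Nat.Tactic.RingSolver using (solve-∀)
  regroup : ∀ n c → 2 N.* (n N.+ c) N.+ suc n ≡ (2 N.* c N.+ n) N.+ suc (n N.+ n)
  regroup = solve-∀
  square-suc : ∀ n → n N.* n N.+ suc (n N.+ n) ≡ suc n N.* suc n
  square-suc = solve-∀

module _ {c ℓ} (F : CharZeroField c ℓ) where
  open CharZeroField F hiding (zero)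
  open ℤ-Solver commRing using (solve; _:=_; _:+_; _:*_; :-_; _:-_; con)
  open import Algebra.Properties.Ring ring using (-‿involutive; -0#≈0#)
  open import Algebra.Properties.Semiring.Mult semiring using (×-homo-+; ×1-homo-*)
  open import Algebra.Properties.Semiring.Exp semiring using (^-congˡ; ^-homo-*)
  open import Algebra.Properties.CommutativeSemiring.Exp commutativeSemiring using (^-distrib-*)
  open import Relation.Binary.Reasoning.Setoid setoid

  *-cancelˡ-≉0 : ∀ a w → ¬ (a ≈ 0#) → a * w ≈ 0# → w ≈ 0#
  *-cancelˡ-≉0 a w a≉0 aw≈0 = begin
    w
      ≈⟨ solve 3 (λ w a i → w := (a :* i) :* w :+ (con (+ 1) :- a :* i) :* w) refl w a (inv a) ⟩
    (a * inv a) * w + (1# - a * inv a) * w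
      ≈⟨ +-cong a⁻¹aw≈0 (*-congʳ (+-congˡ (-‿cong (inv-right a a≉0)))) ⟩
    0# + (1# - 1#) * w
      ≈⟨ solve 1 (λ w → con (+ 0) :+ (con (+ 1) :- con (+ 1)) :* w := con (+ 0)) refl w ⟩
    0# ∎
    where
    a⁻¹aw≈0 : (a * inv a) * w ≈ 0#
    a⁻¹aw≈0 = trans (solve 3 (λ a i w → (a :* i) :* w := i :* (a :* w)) refl a (inv a) w)
                    (trans (*-congˡ aw≈0) (zeroʳ _))

  x≉y⇒x-y≉0 : ∀ x y → ¬ (x ≈ y) → ¬ (x - y ≈ 0#)
  x≉y⇒x-y≉0 x y x≉y x-y≈0 = x≉y (begin
    x             ≈⟨ solve 2 (λ x y → x := (x :- y) :+ y) refl x y ⟩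
    (x - y) + y   ≈⟨ +-congʳ x-y≈0 ⟩
    0# + y        ≈⟨ +-identityˡ y ⟩
    y             ∎)

  ι-+ : ∀ a b → ι (a N.+ b) ≈ ι a + ι b
  ι-+ a b = ×-homo-+ 1# a b

  ι-* : ∀ a b → ι (a N.* b) ≈ ι a * ι b
  ι-* a b = ×1-homo-* a b

  ι1≈1 : ι 1 ≈ 1#
  ι1≈1 = +-identityʳ 1#

  ^-zeroˡ : ∀ k → 1# ^ k ≈ 1#
  ^-zeroˡ zero    = refl
  ^-zeroˡ (suc k) = trans (*-identityˡ _) (^-zeroˡ k)

  ι-<⇒≉ : ∀ {i j} → i < j → ¬ (ι j ≈ ι i)
  ι-<⇒≉ {i} {j} i<j ιj≈ιi = char-zero e (begin
    ι (suc e)                ≈⟨ solve 2 (λ a b → b := (a :+ b) :- a) refl (ι i) (ι (suc e)) ⟩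
    (ι i + ι (suc e)) - ι i  ≈⟨ +-congʳ (ι-+ i (suc e)) ⟨
    ι (i N.+ suc e) - ι i    ≡⟨ ≡.cong (λ k → ι k - ι i) i+[1+e]≡j ⟩
    ι j - ι i                ≈⟨ +-congʳ ιj≈ιi ⟩
    ι i - ι i                ≈⟨ -‿inverseʳ _ ⟩
    0#                       ∎)
    where
    e = j ∸ suc i
    i+[1+e]≡j : i N.+ suc e ≡ j
    i+[1+e]≡j = ≡.trans (ℕP.+-suc i e) (ℕP.m+[n∸m]≡n i<j)

  -- Polynomials are coefficient sequences; a polynomial of degree < N
  -- is evaluated through its first N coefficients.
  horner : List Carrier → Carrier → Carrier
  horner []       x = 0#
  horner (a ∷ as) x = a + x * horner as x

  eval : ℕ → (ℕ → Carrier) → Carrier → Carrier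
  eval N f = horner (applyUpTo f N)

  shift : (ℕ → Carrier) → ℕ → Carrier
  shift f zero    = 0#
  shift f (suc k) = f k

  one : ℕ → Carrier
  one zero    = 1#
  one (suc k) = 0#

  eval-cong : ∀ N f g x → (∀ k → f k ≈ g k) → eval N f x ≈ eval N g x
  eval-cong zero    f g x f≈g = refl
  eval-cong (suc N) f g x f≈g = +-cong (f≈g 0) (*-congˡ (eval-cong N _ _ x (λ k → f≈g (suc k))))

  eval-zero : ∀ N f x → (∀ k → k < N → f k ≈ 0#) → eval N f x ≈ 0#
  eval-zero zero    f x f≈0 = refl
  eval-zero (suc N) f x f≈0 = begin
    f 0 + x * eval N (λ k → f (suc k)) x
      ≈⟨ +-cong (f≈0 0 (s≤s z≤n)) (*-congˡ (eval-zero N _ x (λ k k<N → f≈0 (suc k) (s≤s k<N)))) ⟩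
    0# + x * 0#
      ≈⟨ solve 1 (λ x → con (+ 0) :+ x :* con (+ 0) := con (+ 0)) refl x ⟩
    0# ∎

  eval-+ : ∀ N f g x → eval N (λ k → f k + g k) x ≈ eval N f x + eval N g x
  eval-+ zero    f g x = sym (+-identityʳ 0#)
  eval-+ (suc N) f g x = begin
    (f 0 + g 0) + x * eval N (λ k → f (suc k) + g (suc k)) x
      ≈⟨ +-congˡ (*-congˡ (eval-+ N _ _ x)) ⟩
    (f 0 + g 0) + x * (F′ + G′)
      ≈⟨ solve 5 (λ a b x A B → (a :+ b) :+ x :* (A :+ B) := (a :+ x :* A) :+ (b :+ x :* B))
                 refl (f 0) (g 0) x F′ G′ ⟩
    (f 0 + x * F′) + (g 0 + x * G′) ∎
    where
    F′ = eval N (λ k → f (suc k)) x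
    G′ = eval N (λ k → g (suc k)) x

  eval-*ˡ : ∀ N a f x → eval N (λ k → a * f k) x ≈ a * eval N f x
  eval-*ˡ zero    a f x = sym (zeroʳ a)
  eval-*ˡ (suc N) a f x = begin
    a * f 0 + x * eval N (λ k → a * f (suc k)) x
      ≈⟨ +-congˡ (*-congˡ (eval-*ˡ N a _ x)) ⟩
    a * f 0 + x * (a * F′)
      ≈⟨ solve 4 (λ a b x A → a :* b :+ x :* (a :* A) := a :* (b :+ x :* A)) refl a (f 0) x F′ ⟩
    a * (f 0 + x * F′) ∎
    where F′ = eval N (λ k → f (suc k)) x

  eval-neg : ∀ N f x → eval N (λ k → - f k) x ≈ - eval N f x
  eval-neg zero    f x = sym -0#≈0#
  eval-neg (suc N) f x = begin
    - f 0 + x * eval N (λ k → - f (suc k)) x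
      ≈⟨ +-congˡ (*-congˡ (eval-neg N _ x)) ⟩
    - f 0 + x * (- F′)
      ≈⟨ solve 3 (λ b x A → :- b :+ x :* (:- A) := :- (b :+ x :* A)) refl (f 0) x F′ ⟩
    - (f 0 + x * F′) ∎
    where F′ = eval N (λ k → f (suc k)) x

  eval-shift : ∀ N f x → eval (suc N) (shift f) x ≈ x * eval N f x
  eval-shift N f x = +-identityˡ _

  eval-one : ∀ N x → eval (suc N) one x ≈ 1#
  eval-one N x = begin
    1# + x * eval N (λ _ → 0#) x  ≈⟨ +-congˡ (*-congˡ (eval-zero N _ x (λ _ _ → refl))) ⟩
    1# + x * 0#                   ≈⟨ solve 1 (λ x → con (+ 1) :+ x :* con (+ 0) := con (+ 1)) refl x ⟩
    1#                            ∎

  eval-suc : ∀ N f x → eval (suc N) f x ≈ eval N f x + f N * x ^ N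
  eval-suc zero    f x = solve 2 (λ a x → a :+ x :* con (+ 0) := con (+ 0) :+ a :* con (+ 1)) refl (f 0) x
  eval-suc (suc N) f x = begin
    f 0 + x * eval (suc N) f′ x
      ≈⟨ +-congˡ (*-congˡ (eval-suc N f′ x)) ⟩
    f 0 + x * (eval N f′ x + f′ N * x ^ N)
      ≈⟨ solve 5 (λ a x A b P → a :+ x :* (A :+ b :* P) := (a :+ x :* A) :+ b :* (x :* P))
                 refl (f 0) x (eval N f′ x) (f′ N) (x ^ N) ⟩
    eval (suc N) f x + f (suc N) * x ^ suc N ∎
    where f′ = λ k → f (suc k)

  quotient : Carrier → List Carrier → List Carrier
  quotient a []       = []
  quotient a (b ∷ bs) = horner (b ∷ bs) a ∷ quotient a bs

  length-quotient : ∀ a p → length (quotient a p) ≡ length p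
  length-quotient a []       = ≡.refl
  length-quotient a (b ∷ bs) = ≡.cong suc (length-quotient a bs)

  horner-quotient : ∀ b p x a → horner (b ∷ p) x ≈ (x - a) * horner (quotient a p) x + horner (b ∷ p) a
  horner-quotient b []      x a =
    solve 3 (λ b x a → b :+ x :* con (+ 0) := (x :- a) :* con (+ 0) :+ (b :+ a :* con (+ 0))) refl b x a
  horner-quotient b (d ∷ p) x a = begin
    b + x * horner (d ∷ p) x
      ≈⟨ +-congˡ (*-congˡ (horner-quotient d p x a)) ⟩
    b + x * ((x - a) * horner (quotient a p) x + horner (d ∷ p) a)
      ≈⟨ solve 5 (λ b x a W V → b :+ x :* ((x :- a) :* W :+ V) := (x :- a) :* (V :+ x :* W) :+ (b :+ a :* V))
                 refl b x a (horner (quotient a p) x) (horner (d ∷ p) a) ⟩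
    (x - a) * horner (quotient a (d ∷ p)) x + horner (b ∷ d ∷ p) a ∎

  AllZero : List Carrier → Set (c ⊔ ℓ)
  AllZero = All (_≈ 0#)

  horner-AllZero : ∀ p x → AllZero p → horner p x ≈ 0#
  horner-AllZero []      x []         = refl
  horner-AllZero (d ∷ p) x (d≈0 ∷ p≈0) = begin
    d + x * horner p x  ≈⟨ +-cong d≈0 (*-congˡ (horner-AllZero p x p≈0)) ⟩
    0# + x * 0#         ≈⟨ solve 1 (λ x → con (+ 0) :+ x :* con (+ 0) := con (+ 0)) refl x ⟩
    0#                  ∎

  head≈0 : ∀ d p a → horner (d ∷ p) a ≈ 0# → AllZero p → d ≈ 0#
  head≈0 d p a pa≈0 p≈0 = begin
    d
      ≈⟨ solve 3 (λ d a E → d := (d :+ a :* E) :- a :* E) refl d a (horner p a) ⟩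
    (d + a * horner p a) - a * horner p a
      ≈⟨ +-cong pa≈0 (-‿cong (*-congˡ (horner-AllZero p a p≈0))) ⟩
    0# - a * 0#
      ≈⟨ solve 1 (λ a → con (+ 0) :- a :* con (+ 0) := con (+ 0)) refl a ⟩
    0# ∎

  quotient-AllZero : ∀ a p → AllZero (quotient a p) → AllZero p
  quotient-AllZero a []      []            = []
  quotient-AllZero a (d ∷ p) (pa≈0 ∷ q≈0) = head≈0 d p a pa≈0 p≈0 ∷ p≈0
    where p≈0 = quotient-AllZero a p q≈0

  Distinct : ℕ → (ℕ → Carrier) → Set ℓ
  Distinct N pt = ∀ i j → i < j → j < N → ¬ (pt j ≈ pt i)

  horner-roots⇒AllZero : ∀ N p (pt : ℕ → Carrier) → length p ≤ N → Distinct N pt →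
                          (∀ i → i < N → horner p (pt i) ≈ 0#) → AllZero p
  horner-roots⇒AllZero N       []      pt _ _ _ = []
  horner-roots⇒AllZero (suc N) (b ∷ p) pt (s≤s |p|≤N) distinct roots =
    head≈0 b p a (roots 0 (s≤s z≤n)) p≈0 ∷ p≈0
    where
    a = pt 0
    quotient-roots : ∀ i → i < N → horner (quotient a p) (pt (suc i)) ≈ 0#
    quotient-roots i i<N = *-cancelˡ-≉0 (pt (suc i) - a) _ (x≉y⇒x-y≉0 _ _ (distinct 0 (suc i) (s≤s z≤n) (s≤s i<N))) (begin
      (pt (suc i) - a) * horner (quotient a p) (pt (suc i))
        ≈⟨ +-identityʳ _ ⟨
      (pt (suc i) - a) * horner (quotient a p) (pt (suc i)) + 0#
        ≈⟨ +-congˡ (roots 0 (s≤s z≤n)) ⟨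
      (pt (suc i) - a) * horner (quotient a p) (pt (suc i)) + horner (b ∷ p) a
        ≈⟨ horner-quotient b p (pt (suc i)) a ⟨
      horner (b ∷ p) (pt (suc i))
        ≈⟨ roots (suc i) (s≤s i<N) ⟩
      0# ∎)
    p≈0 : AllZero p
    p≈0 = quotient-AllZero a p (horner-roots⇒AllZero N (quotient a p) (λ i → pt (suc i))
            (≡.subst (_≤ N) (≡.sym (length-quotient a p)) |p|≤N)
            (λ i j i<j j<N → distinct (suc i) (suc j) (s≤s i<j) (s≤s j<N)) quotient-roots)

  eval-roots⇒zero : ∀ N f (pt : ℕ → Carrier) → Distinct N pt → (∀ i → i < N → eval N f (pt i) ≈ 0#) →
                    ∀ k → k < N → f k ≈ 0#
  eval-roots⇒zero N f pt distinct roots k k<N = All.lookup f≈0 (∈-applyUpTo⁺ f k<N)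
    where
    f≈0 = horner-roots⇒AllZero N (applyUpTo f N) pt (ℕP.≤-reflexive (LP.length-applyUpTo f N)) distinct roots

  eval≈0⇒zero : ∀ N f → (∀ i → eval N f (ι i) ≈ 0#) → ∀ k → k < N → f k ≈ 0#
  eval≈0⇒zero N f vanishes = eval-roots⇒zero N f ι (λ i j i<j _ → ι-<⇒≉ i<j) (λ i _ → vanishes i)

  Π-map-* : ∀ {a} {A : Set a} (f g : A → Carrier) L → Π (map (λ x → f x * g x) L) ≈ Π (map f L) * Π (map g L)
  Π-map-* f g []      = sym (*-identityʳ 1#)
  Π-map-* f g (x ∷ L) = trans (*-congˡ (Π-map-* f g L))
    (solve 4 (λ a b P Q → (a :* b) :* (P :* Q) := (a :* P) :* (b :* Q)) refl (f x) (g x) (Π (map f L)) (Π (map g L)))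

  Π-map-cong : ∀ {a p} {A : Set a} {P : A → Set p} (f g : A → Carrier) {L} → All P L →
               (∀ {x} → P x → f x ≈ g x) → Π (map f L) ≈ Π (map g L)
  Π-map-cong f g []         f≈g = refl
  Π-map-cong f g (px ∷ pxs) f≈g = *-cong (f≈g px) (Π-map-cong f g pxs f≈g)

  Π-map-root : ∀ {x} L → x ∈ L → Π (map (λ r → x - r) L) ≈ 0#
  Π-map-root (r ∷ L) (here x≡r) = trans (*-congʳ (trans (+-congˡ (-‿cong (reflexive (≡.sym x≡r)))) (-‿inverseʳ _))) (zeroˡ _)
  Π-map-root (r ∷ L) (there x∈L) = trans (*-congˡ (Π-map-root L x∈L)) (zeroʳ _)

  charPoly : List Carrier → ℕ → Carrier
  charPoly []      = one
  charPoly (a ∷ L) k = shift (charPoly L) k + (- a) * charPoly L k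

  dualCharPoly : List Carrier → ℕ → Carrier
  dualCharPoly []      = one
  dualCharPoly (a ∷ L) k = dualCharPoly L k + (- a) * shift (dualCharPoly L) k

  eval-charPoly : ∀ L N x → length L < N → eval N (charPoly L) x ≈ Π (map (λ r → x - r) L)
  eval-charPoly []      (suc N) x _         = eval-one N x
  eval-charPoly (a ∷ L) (suc N) x (s≤s |L|<N) = begin
    eval (suc N) (charPoly (a ∷ L)) x
      ≈⟨ eval-+ (suc N) (shift (charPoly L)) (λ k → (- a) * charPoly L k) x ⟩
    eval (suc N) (shift (charPoly L)) x + eval (suc N) (λ k → (- a) * charPoly L k) x
      ≈⟨ +-congˡ (eval-*ˡ (suc N) (- a) (charPoly L) x) ⟩
    eval (suc N) (shift (charPoly L)) x + (- a) * eval (suc N) (charPoly L) x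
      ≈⟨ +-cong (trans (eval-shift N (charPoly L) x) (*-congˡ (eval-charPoly L N x |L|<N)))
                (*-congˡ (eval-charPoly L (suc N) x (ℕP.m≤n⇒m≤1+n |L|<N))) ⟩
    x * P + (- a) * P
      ≈⟨ solve 3 (λ P a x → x :* P :+ (:- a) :* P := (x :- a) :* P) refl P a x ⟩
    (x - a) * P ∎
    where P = Π (map (λ r → x - r) L)

  eval-dualCharPoly : ∀ L N x → length L < N → eval N (dualCharPoly L) x ≈ Π (map (λ a → 1# - a * x) L)
  eval-dualCharPoly []      (suc N) x _           = eval-one N x
  eval-dualCharPoly (a ∷ L) (suc N) x (s≤s |L|<N) = begin
    eval (suc N) (dualCharPoly (a ∷ L)) x
      ≈⟨ eval-+ (suc N) (dualCharPoly L) (λ k → (- a) * shift (dualCharPoly L) k) x ⟩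
    eval (suc N) (dualCharPoly L) x + eval (suc N) (λ k → (- a) * shift (dualCharPoly L) k) x
      ≈⟨ +-congˡ (eval-*ˡ (suc N) (- a) (shift (dualCharPoly L)) x) ⟩
    eval (suc N) (dualCharPoly L) x + (- a) * eval (suc N) (shift (dualCharPoly L)) x
      ≈⟨ +-cong (eval-dualCharPoly L (suc N) x (ℕP.m≤n⇒m≤1+n |L|<N))
                (*-congˡ (trans (eval-shift N (dualCharPoly L) x) (*-congˡ (eval-dualCharPoly L N x |L|<N)))) ⟩
    P + (- a) * (x * P)
      ≈⟨ solve 3 (λ P a x → P :+ (:- a) :* (x :* P) := (con (+ 1) :- a :* x) :* P) refl P a x ⟩
    (1# - a * x) * P ∎
    where P = Π (map (λ a → 1# - a * x) L)

  charPoly-degree : ∀ L k → length L < k → charPoly L k ≈ 0#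
  charPoly-degree []      (suc k) _         = refl
  charPoly-degree (a ∷ L) (suc k) (s≤s |L|<k) = begin
    charPoly L k + (- a) * charPoly L (suc k)
      ≈⟨ +-cong (charPoly-degree L k |L|<k) (*-congˡ (charPoly-degree L (suc k) (ℕP.m≤n⇒m≤1+n |L|<k))) ⟩
    0# + (- a) * 0#
      ≈⟨ solve 1 (λ a → con (+ 0) :+ (:- a) :* con (+ 0) := con (+ 0)) refl a ⟩
    0# ∎

  charPoly-monic : ∀ L → charPoly L (length L) ≈ 1#
  charPoly-monic []      = refl
  charPoly-monic (a ∷ L) = begin
    charPoly L (length L) + (- a) * charPoly L (suc (length L))
      ≈⟨ +-cong (charPoly-monic L) (*-congˡ (charPoly-degree L (suc (length L)) ℕP.≤-refl)) ⟩
    1# + (- a) * 0#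
      ≈⟨ solve 1 (λ a → con (+ 1) :+ (:- a) :* con (+ 0) := con (+ 1)) refl a ⟩
    1# ∎

  dualCharPoly-0 : ∀ L → dualCharPoly L 0 ≈ 1#
  dualCharPoly-0 []      = refl
  dualCharPoly-0 (a ∷ L) = trans (+-cong (dualCharPoly-0 L) (zeroʳ _)) (+-identityʳ _)

  monomial : ℕ → ℕ → Carrier
  monomial zero    = one
  monomial (suc n) = shift (monomial n)

  monomial-n : ∀ n → monomial n n ≡ 1#
  monomial-n zero    = ≡.refl
  monomial-n (suc n) = monomial-n n

  eval-monomial : ∀ n N x → n < N → eval N (monomial n) x ≈ x ^ n
  eval-monomial zero    (suc N) x _         = eval-one N x
  eval-monomial (suc n) (suc N) x (s≤s n<N) = trans (eval-shift N (monomial n) x) (*-congˡ (eval-monomial n N x n<N))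

  binomial : ℕ → ℕ → Carrier
  binomial n k = ι (n C k)

  binomial-suc : ∀ n k → binomial (suc n) k ≈ shift (binomial n) k + binomial n k
  binomial-suc n zero    = trans ι1≈1 (sym (trans (+-identityˡ _) ι1≈1))
  binomial-suc n (suc k) = begin
    ι (suc n C suc k)          ≡⟨ ≡.cong ι (nCk+nC[k+1]≡[n+1]C[k+1] n k) ⟨
    ι (n C k N.+ n C suc k)    ≈⟨ ι-+ (n C k) (n C suc k) ⟩
    ι (n C k) + ι (n C suc k)  ∎

  eval-binomial : ∀ n N x → n < N → eval N (binomial n) x ≈ (1# + x) ^ n
  eval-binomial zero    (suc N) x _ = begin
    ι 1 + x * eval N (λ _ → ι 0) x  ≈⟨ +-cong ι1≈1 (*-congˡ (eval-zero N _ x (λ _ _ → refl))) ⟩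
    1# + x * 0#                     ≈⟨ solve 1 (λ x → con (+ 1) :+ x :* con (+ 0) := con (+ 1)) refl x ⟩
    1#                              ∎
  eval-binomial (suc n) (suc N) x (s≤s n<N) = begin
    eval (suc N) (binomial (suc n)) x
      ≈⟨ eval-cong (suc N) _ _ x (binomial-suc n) ⟩
    eval (suc N) (λ k → shift (binomial n) k + binomial n k) x
      ≈⟨ eval-+ (suc N) (shift (binomial n)) (binomial n) x ⟩
    eval (suc N) (shift (binomial n)) x + eval (suc N) (binomial n) x
      ≈⟨ +-cong (trans (eval-shift N (binomial n) x) (*-congˡ (eval-binomial n N x n<N)))
                (eval-binomial n (suc N) x (ℕP.m≤n⇒m≤1+n n<N)) ⟩
    x * P + P
      ≈⟨ solve 2 (λ x P → x :* P :+ P := (con (+ 1) :+ x) :* P) refl x P ⟩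
    (1# + x) * P ∎
    where P = (1# + x) ^ n

  atNeg : (ℕ → Carrier) → ℕ → Carrier
  atNeg f zero    = f 0
  atNeg f (suc k) = - atNeg (λ j → f (suc j)) k

  atNeg-sign : ∀ f k → atNeg f k ≈ (- 1#) ^ k * f k
  atNeg-sign f zero    = sym (*-identityˡ _)
  atNeg-sign f (suc k) = trans (-‿cong (atNeg-sign _ k))
    (solve 2 (λ s y → :- (s :* y) := (:- con (+ 1) :* s) :* y) refl ((- 1#) ^ k) (f (suc k)))

  eval-atNeg : ∀ N f x → eval N (atNeg f) x ≈ eval N f (- x)
  eval-atNeg zero    f x = refl
  eval-atNeg (suc N) f x = begin
    f 0 + x * eval N (λ k → - atNeg f′ k) x
      ≈⟨ +-congˡ (*-congˡ (trans (eval-neg N _ x) (-‿cong (eval-atNeg N f′ x)))) ⟩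
    f 0 + x * (- E)
      ≈⟨ solve 3 (λ a x E → a :+ x :* (:- E) := a :+ (:- x) :* E) refl (f 0) x E ⟩
    f 0 + (- x) * E ∎
    where
    f′ = λ j → f (suc j)
    E  = eval N f′ (- x)

  atNeg-double : ∀ f k → atNeg f (double k) ≈ f (double k)
  atNeg-double f zero    = refl
  atNeg-double f (suc k) = trans (-‿involutive _) (atNeg-double (λ j → f (suc (suc j))) k)

  atSquare : (ℕ → Carrier) → ℕ → Carrier
  atSquare f zero          = f 0
  atSquare f (suc zero)    = 0#
  atSquare f (suc (suc k)) = atSquare (λ j → f (suc j)) k

  atSquare-double : ∀ f k → atSquare f (double k) ≡ f k
  atSquare-double f zero    = ≡.refl
  atSquare-double f (suc k) = atSquare-double (λ j → f (suc j)) k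

  eval-atSquare : ∀ N f s → eval (double N) (atSquare f) s ≈ eval N f (s * s)
  eval-atSquare zero    f s = refl
  eval-atSquare (suc N) f s = begin
    f 0 + s * (0# + s * eval (double N) (atSquare f′) s)
      ≈⟨ +-congˡ (*-congˡ (+-congˡ (*-congˡ (eval-atSquare N f′ s)))) ⟩
    f 0 + s * (0# + s * E)
      ≈⟨ solve 3 (λ a s E → a :+ s :* (con (+ 0) :+ s :* E) := a :+ (s :* s) :* E) refl (f 0) s E ⟩
    f 0 + (s * s) * E ∎
    where
    f′ = λ j → f (suc j)
    E  = eval N f′ (s * s)

  completeHom : List Carrier → ℕ → Carrier
  completeHom xs       zero    = 1#
  completeHom []       (suc m) = 0#
  completeHom (x ∷ xs) (suc m) = completeHom xs (suc m) + x * completeHom (x ∷ xs) m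

  convolution : (ℕ → Carrier) → (ℕ → Carrier) → ℕ → Carrier
  convolution b a zero    = b 0 * a 0
  convolution b a (suc m) = b 0 * a (suc m) + convolution (λ j → b (suc j)) a m

  convolution-congˡ : ∀ b b′ a m → (∀ j → b j ≈ b′ j) → convolution b a m ≈ convolution b′ a m
  convolution-congˡ b b′ a zero    b≈b′ = *-congʳ (b≈b′ 0)
  convolution-congˡ b b′ a (suc m) b≈b′ = +-cong (*-congʳ (b≈b′ 0)) (convolution-congˡ _ _ a m (λ j → b≈b′ (suc j)))

  convolution-+ˡ : ∀ b b′ a m → convolution (λ j → b j + b′ j) a m ≈ convolution b a m + convolution b′ a m
  convolution-+ˡ b b′ a zero    = distribʳ _ _ _
  convolution-+ˡ b b′ a (suc m) = trans (+-cong (distribʳ _ _ _) (convolution-+ˡ _ _ a m))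
    (solve 4 (λ p q r s → (p :+ q) :+ (r :+ s) := (p :+ r) :+ (q :+ s)) refl _ _ _ _)

  convolution-+ʳ : ∀ b a a′ m → convolution b (λ j → a j + a′ j) m ≈ convolution b a m + convolution b a′ m
  convolution-+ʳ b a a′ zero    = distribˡ _ _ _
  convolution-+ʳ b a a′ (suc m) = trans (+-cong (distribˡ _ _ _) (convolution-+ʳ _ a a′ m))
    (solve 4 (λ p q r s → (p :+ q) :+ (r :+ s) := (p :+ r) :+ (q :+ s)) refl _ _ _ _)

  convolution-*ˡ : ∀ k b a m → convolution (λ j → k * b j) a m ≈ k * convolution b a m
  convolution-*ˡ k b a zero    = *-assoc _ _ _
  convolution-*ˡ k b a (suc m) = trans (+-cong (*-assoc _ _ _) (convolution-*ˡ k _ a m)) (sym (distribˡ _ _ _))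

  convolution-*ʳ : ∀ k b a m → convolution b (λ j → k * a j) m ≈ k * convolution b a m
  convolution-*ʳ k b a zero    = solve 3 (λ k b a → b :* (k :* a) := k :* (b :* a)) refl k (b 0) (a 0)
  convolution-*ʳ k b a (suc m) = trans
    (+-cong (solve 3 (λ k b a → b :* (k :* a) := k :* (b :* a)) refl k (b 0) (a (suc m))) (convolution-*ʳ k _ a m))
    (sym (distribˡ _ _ _))

  convolution-shiftʳ : ∀ b a m → convolution b (shift a) (suc m) ≈ convolution b a m
  convolution-shiftʳ b a zero    = trans (+-congˡ (zeroʳ _)) (+-identityʳ _)
  convolution-shiftʳ b a (suc m) = +-congˡ (convolution-shiftʳ _ a m)

  convolution-shiftˡ : ∀ b a m → convolution (shift b) a (suc m) ≈ convolution b a m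
  convolution-shiftˡ b a m = trans (+-congʳ (zeroˡ _)) (+-identityˡ _)

  convolution-zeroˡ : ∀ a m → convolution (λ _ → 0#) a m ≈ 0#
  convolution-zeroˡ a zero    = zeroˡ _
  convolution-zeroˡ a (suc m) = trans (+-cong (zeroˡ _) (convolution-zeroˡ a m)) (+-identityʳ 0#)

  convolution-one : ∀ a m → convolution one a m ≈ a m
  convolution-one a zero    = *-identityˡ _
  convolution-one a (suc m) = trans (+-cong (*-identityˡ _) (convolution-zeroˡ a m)) (+-identityʳ _)

  -- The generating function of the h_m is 1 / ∏ (1 - x t).
  completeHom⋆dualCharPoly : ∀ xs k → convolution (completeHom xs) (dualCharPoly xs) k ≈ one k
  completeHom⋆dualCharPoly [] k = trans (convolution-congˡ (completeHom []) one one k h[]≈one) (convolution-one one k)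
    where
    h[]≈one : ∀ j → completeHom [] j ≈ one j
    h[]≈one zero    = refl
    h[]≈one (suc j) = refl
  completeHom⋆dualCharPoly (x ∷ ys) k = begin
    convolution h′ (λ j → e j + (- x) * shift e j) k
      ≈⟨ convolution-+ʳ h′ e _ k ⟩
    convolution h′ e k + convolution h′ (λ j → (- x) * shift e j) k
      ≈⟨ +-congˡ (convolution-*ʳ (- x) h′ (shift e) k) ⟩
    convolution h′ e k + (- x) * convolution h′ (shift e) k
      ≈⟨ peel k ⟩
    convolution h e k
      ≈⟨ completeHom⋆dualCharPoly ys k ⟩
    one k ∎
    where
    e  = dualCharPoly ys
    h  = completeHom ys
    h′ = completeHom (x ∷ ys)
    h′-xh′≈h : ∀ j → h′ j + (- x) * shift h′ j ≈ h j
    h′-xh′≈h zero    = trans (+-congˡ (zeroʳ _)) (+-identityʳ _)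
    h′-xh′≈h (suc j) = solve 3 (λ p x q → (p :+ x :* q) :+ (:- x) :* q := p) refl (h (suc j)) x (h′ j)
    peel : ∀ k → convolution h′ e k + (- x) * convolution h′ (shift e) k ≈ convolution h e k
    peel zero    = solve 2 (λ a x → con (+ 1) :* a :+ (:- x) :* (con (+ 1) :* con (+ 0)) := con (+ 1) :* a) refl (e 0) x
    peel (suc k) = begin
      convolution h′ e (suc k) + (- x) * convolution h′ (shift e) (suc k)
        ≈⟨ +-congˡ (*-congˡ (trans (convolution-shiftʳ h′ e k) (sym (convolution-shiftˡ h′ e k)))) ⟩
      convolution h′ e (suc k) + (- x) * convolution (shift h′) e (suc k)
        ≈⟨ +-congˡ (convolution-*ˡ (- x) (shift h′) e (suc k)) ⟨
      convolution h′ e (suc k) + convolution (λ j → (- x) * shift h′ j) e (suc k)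
        ≈⟨ convolution-+ˡ h′ (λ j → (- x) * shift h′ j) e (suc k) ⟨
      convolution (λ j → h′ j + (- x) * shift h′ j) e (suc k)
        ≈⟨ convolution-congˡ _ h e (suc k) h′-xh′≈h ⟩
      convolution h e (suc k) ∎

  Σ< : ℕ → (ℕ → Carrier) → Carrier
  Σ< zero    g = 0#
  Σ< (suc m) g = g 0 + Σ< m (λ j → g (suc j))

  Σ<-cong : ∀ m g g′ → (∀ j → g j ≈ g′ j) → Σ< m g ≈ Σ< m g′
  Σ<-cong zero    g g′ g≈g′ = refl
  Σ<-cong (suc m) g g′ g≈g′ = +-cong (g≈g′ 0) (Σ<-cong m _ _ (λ j → g≈g′ (suc j)))

  Σ<-suc : ∀ m g → Σ< (suc m) g ≈ Σ< m g + g m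
  Σ<-suc zero    g = trans (+-identityʳ _) (sym (+-identityˡ _))
  Σ<-suc (suc m) g = trans (+-congˡ (Σ<-suc m _)) (sym (+-assoc _ _ _))

  Σ-map-applyUpTo : ∀ (g : ℕ → Carrier) f m → Σ (map g (applyUpTo f m)) ≡ Σ< m (λ j → g (f j))
  Σ-map-applyUpTo g f zero    = ≡.refl
  Σ-map-applyUpTo g f (suc m) = ≡.cong (λ s → g (f 0) + s) (Σ-map-applyUpTo g (λ j → f (suc j)) m)

  convolution≈Σ< : ∀ b a m → convolution b a m ≈ Σ< (suc m) (λ j → b j * a (m ∸ j))
  convolution≈Σ< b a zero    = sym (+-identityʳ _)
  convolution≈Σ< b a (suc m) = +-congˡ (convolution≈Σ< _ a m)

  completeHom-recurrence : ∀ xs m →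
    completeHom xs (suc m) ≈ - Σ< (suc m) (λ j → completeHom xs j * dualCharPoly xs (suc m ∸ j))
  completeHom-recurrence xs m = begin
    h
      ≈⟨ solve 2 (λ h s → h := (s :+ h :* con (+ 1)) :+ (:- s)) refl h S ⟩
    (S + h * 1#) + - S
      ≈⟨ +-congʳ (+-congˡ (*-congˡ e₀≈1)) ⟨
    (S + h * dualCharPoly xs (suc m ∸ suc m)) + - S
      ≈⟨ +-congʳ (Σ<-suc (suc m) g) ⟨
    Σ< (suc (suc m)) g + - S
      ≈⟨ +-congʳ (convolution≈Σ< (completeHom xs) (dualCharPoly xs) (suc m)) ⟨
    convolution (completeHom xs) (dualCharPoly xs) (suc m) + - S
      ≈⟨ +-congʳ (completeHom⋆dualCharPoly xs (suc m)) ⟩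
    0# + - S
      ≈⟨ +-identityˡ _ ⟩
    - S ∎
    where
    h = completeHom xs (suc m)
    g = λ j → completeHom xs j * dualCharPoly xs (suc m ∸ j)
    S = Σ< (suc m) g
    e₀≈1 : dualCharPoly xs (suc m ∸ suc m) ≈ 1#
    e₀≈1 = ≡.subst (λ i → dualCharPoly xs i ≈ 1#) (≡.sym (ℕP.n∸n≡0 m)) (dualCharPoly-0 xs)

  -- With u = 1 - z, this is 1 - s²/u² = (u - s)(u + s)/u².
  1-[1-z]⁻²s²-factor : ∀ z s → ¬ (z ≈ 1#) →
    1# - inv (1# - z) ^ 2 * (s * s) ≈ inv (1# - z) ^ 2 * (((1# - s) - z) * ((1# + s) - z))
  1-[1-z]⁻²s²-factor z s z≉1 = begin
    1# - y ^ 2 * (s * s)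
      ≈⟨ trans (+-congˡ (zeroˡ _)) (+-identityʳ _) ⟨
    1# - y ^ 2 * (s * s) + 0# * (u * y + 1#)
      ≈⟨ +-congˡ (*-congʳ uy-1≈0) ⟨
    1# - y ^ 2 * (s * s) + (u * y - 1#) * (u * y + 1#)
      ≈⟨ solve 3 (λ y s z → con (+ 1) :- (y :* (y :* con (+ 1))) :* (s :* s)
                              :+ ((con (+ 1) :- z) :* y :- con (+ 1)) :* ((con (+ 1) :- z) :* y :+ con (+ 1))
                            := (y :* (y :* con (+ 1))) :* (((con (+ 1) :- s) :- z) :* ((con (+ 1) :+ s) :- z)))
                 refl y s z ⟩
    y ^ 2 * (((1# - s) - z) * ((1# + s) - z)) ∎
    where
    u = 1# - z
    y = inv u
    uy-1≈0 : u * y - 1# ≈ 0#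
    uy-1≈0 = trans (+-congʳ (inv-right u (x≉y⇒x-y≉0 1# z (λ 1≈z → z≉1 (sym 1≈z))))) (-‿inverseʳ 1#)

  Σ-map-cong : ∀ {a} {A : Set a} (f g : A → Carrier) L → (∀ x → f x ≈ g x) → Σ (map f L) ≈ Σ (map g L)
  Σ-map-cong f g []      f≈g = refl
  Σ-map-cong f g (x ∷ L) f≈g = +-cong (f≈g x) (Σ-map-cong f g L f≈g)

  Σ-map-++ : ∀ {a} {A : Set a} (g : A → Carrier) xs ys → Σ (map g (xs ++ ys)) ≈ Σ (map g xs) + Σ (map g ys)
  Σ-map-++ g []       ys = sym (+-identityˡ _)
  Σ-map-++ g (x ∷ xs) ys = trans (+-congˡ (Σ-map-++ g xs ys)) (sym (+-assoc _ _ _))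

  Σ-map-concatMap : ∀ {a b} {A : Set a} {B : Set b} (g : A → Carrier) (f : B → List A) L →
                    Σ (map g (concatMap f L)) ≈ Σ (map (λ y → Σ (map g (f y))) L)
  Σ-map-concatMap g f []      = refl
  Σ-map-concatMap g f (y ∷ L) = trans (Σ-map-++ g (f y) (concatMap f L)) (+-congˡ (Σ-map-concatMap g f L))

  -- Summing over lo ≤ i₁ ≤ … ≤ iₘ is the recursion defining h_m on the list of weights from lo on.
  Zstar≈completeHom : ∀ n q s m → Zstar F n q m s ≈ completeHom (map (λ i → inv (1# - q ^ i) ^ s) (range1 n)) m
  Zstar≈completeHom n q s m = trans (Z≥≈completeHom 1 m (n ∸ 1) (s≤s z≤n) ≡.refl)
    (reflexive (≡.cong (λ L → completeHom (map w L) m) (≡.sym (range1≡interval n))))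
    where
    w : ℕ → Carrier
    w i = inv (1# - q ^ i) ^ s

    summand : List ℕ → Carrier
    summand is = Π (map w is)

    Z≥ : ℕ → ℕ → Carrier
    Z≥ lo m = Σ (map summand (nondecSeqs n lo m))

    Σ-map-cons : ∀ i L → Σ (map summand (map (i ∷_) L)) ≈ w i * Σ (map summand L)
    Σ-map-cons i []       = sym (zeroʳ _)
    Σ-map-cons i (is ∷ L) = trans (+-congˡ (Σ-map-cons i L)) (sym (distribˡ _ _ _))

    Z≥-suc : ∀ lo k m → 1 ≤ lo → lo N.+ k ≡ suc (n ∸ 1) →
             Z≥ lo (suc m) ≈ Σ (map (λ i → w i * Z≥ i m) (interval lo k))
    Z≥-suc lo k m 1≤lo lo+k≡n = begin
      Σ (map summand (concatMap prefix (filter (lo ≤?_) (range1 n))))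
        ≡⟨ ≡.cong (λ L → Σ (map summand (concatMap prefix L))) suffix ⟩
      Σ (map summand (concatMap prefix (interval lo k)))
        ≈⟨ Σ-map-concatMap summand prefix (interval lo k) ⟩
      Σ (map (λ i → Σ (map summand (prefix i))) (interval lo k))
        ≈⟨ Σ-map-cong _ _ (interval lo k) (λ i → Σ-map-cons i (nondecSeqs n i m)) ⟩
      Σ (map (λ i → w i * Z≥ i m) (interval lo k)) ∎
      where
      prefix : ℕ → List (List ℕ)
      prefix i = map (i ∷_) (nondecSeqs n i m)
      suffix : filter (lo ≤?_) (range1 n) ≡ interval lo k
      suffix = ≡.trans (≡.cong (filter (lo ≤?_)) (range1≡interval n))
                       (filter-interval 1 (n ∸ 1) lo k 1≤lo lo+k≡n)

    Z≥≈completeHom : ∀ lo m k → 1 ≤ lo → lo N.+ k ≡ suc (n ∸ 1) →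
                     Z≥ lo m ≈ completeHom (map w (interval lo k)) m
    Z≥≈completeHom lo zero    k _    _       = +-identityʳ 1#
    Z≥≈completeHom lo (suc m) k 1≤lo lo+k≡n = trans (Z≥-suc lo k m 1≤lo lo+k≡n) (tails k lo 1≤lo lo+k≡n)
      where
      tails : ∀ k lo → 1 ≤ lo → lo N.+ k ≡ suc (n ∸ 1) →
              Σ (map (λ i → w i * Z≥ i m) (interval lo k)) ≈ completeHom (map w (interval lo k)) (suc m)
      tails zero    lo _    _       = refl
      tails (suc k) lo 1≤lo lo+k≡n = begin
        w lo * Z≥ lo m + Σ (map (λ i → w i * Z≥ i m) (interval (suc lo) k))
          ≈⟨ +-cong (*-congˡ (Z≥≈completeHom lo m (suc k) 1≤lo lo+k≡n))
                    (tails k (suc lo) (ℕP.m≤n⇒m≤1+n 1≤lo) (≡.trans (≡.sym (ℕP.+-suc lo k)) lo+k≡n)) ⟩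
        w lo * completeHom (map w (interval lo (suc k))) m + completeHom (map w (interval (suc lo) k)) (suc m)
          ≈⟨ +-comm _ _ ⟩
        completeHom (map w (interval lo (suc k))) (suc m) ∎



  module RootsOfUnity (n′ : ℕ) (ζ : Carrier) (ζⁿ≈1 : ζ ^ suc n′ ≈ 1#)
                      (ζ-primitive : ∀ i → 1 ≤ i → i < suc n′ → ¬ (ζ ^ i ≈ 1#)) where

    n : ℕ
    n = suc n′

    nontrivialRoots : List Carrier
    nontrivialRoots = map (ζ ^_) (range1 n)

    roots : List Carrier
    roots = 1# ∷ nontrivialRoots

    length-nontrivialRoots : length nontrivialRoots ≡ n′
    length-nontrivialRoots = ≡.trans (LP.length-map (ζ ^_) (range1 n))
                                     (≡.trans (LP.length-map suc (upTo n′)) (LP.length-upTo n′))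

    length-roots : length roots ≡ n
    length-roots = ≡.cong suc length-nontrivialRoots

    nontrivialRoots-≉1 : All (λ z → ¬ (z ≈ 1#)) nontrivialRoots
    nontrivialRoots-≉1 =
      map⁺ (map⁺ (applyUpTo⁺₁ id n′ (λ {i} i<n′ → ζ-primitive (suc i) (s≤s z≤n) (s≤s i<n′))))

    ζ^-∈-roots : ∀ i → i < n → ζ ^ i ∈ roots
    ζ^-∈-roots zero    _         = here ≡.refl
    ζ^-∈-roots (suc i) (s≤s i<n′) = there (∈-map⁺ (ζ ^_) (∈-map⁺ suc (∈-upTo⁺ i<n′)))

    ζ^-root : ∀ i → (ζ ^ i) ^ n ≈ 1#
    ζ^-root zero    = ^-zeroˡ n
    ζ^-root (suc i) = trans (^-distrib-* ζ (ζ ^ i) n) (trans (*-cong ζⁿ≈1 (ζ^-root i)) (*-identityˡ 1#))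

    -- ζ^j = ζ^i would make ζ^(j - i) = 1.
    ζ^-distinct : Distinct n (ζ ^_)
    ζ^-distinct i j i<j j<n ζʲ≈ζⁱ = ζ-primitive d (ℕP.m<n⇒0<n∸m i<j) (ℕP.≤-<-trans (ℕP.m∸n≤m j i) j<n) (begin
      ζ ^ d                      ≈⟨ *-identityˡ _ ⟨
      1# * ζ ^ d                 ≈⟨ *-congʳ ζ⁻ⁱζⁱ≈1 ⟨
      (ζ⁻ⁱ * ζ ^ i) * ζ ^ d      ≈⟨ *-assoc _ _ _ ⟩
      ζ⁻ⁱ * (ζ ^ i * ζ ^ d)      ≈⟨ *-congˡ (^-homo-* ζ i d) ⟨
      ζ⁻ⁱ * ζ ^ (i N.+ d)        ≡⟨ ≡.cong (λ e → ζ⁻ⁱ * ζ ^ e) (ℕP.m+[n∸m]≡n (ℕP.<⇒≤ i<j)) ⟩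
      ζ⁻ⁱ * ζ ^ j                ≈⟨ *-congˡ ζʲ≈ζⁱ ⟩
      ζ⁻ⁱ * ζ ^ i                ≈⟨ ζ⁻ⁱζⁱ≈1 ⟩
      1#                         ∎)
      where
      d = j ∸ i
      ζ⁻ⁱ = ζ ^ (n ∸ i)
      ζ⁻ⁱζⁱ≈1 : ζ⁻ⁱ * ζ ^ i ≈ 1#
      ζ⁻ⁱζⁱ≈1 = trans (sym (^-homo-* ζ (n ∸ i) i))
                      (trans (reflexive (≡.cong (ζ ^_) (ℕP.m∸n+n≡m (ℕP.<⇒≤ (ℕP.<-trans i<j j<n))))) ζⁿ≈1)

    -- ∏_{r ∈ roots} (x - r) - (xⁿ - 1) has degree < n and vanishes at the n points ζ^i.
    difference : ℕ → Carrier
    difference k = charPoly roots k - (monomial n k - one k)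

    eval-difference : ∀ x → eval n difference x ≈ Π (map (λ r → x - r) roots) - (x ^ n - 1#)
    eval-difference x = begin
      eval n difference x
        ≈⟨ +-identityʳ _ ⟨
      eval n difference x + 0#
        ≈⟨ +-congˡ (trans (*-congʳ difference-n≈0) (zeroˡ _)) ⟨
      eval n difference x + difference n * x ^ n
        ≈⟨ eval-suc n difference x ⟨
      eval (suc n) difference x
        ≈⟨ eval-+ (suc n) (charPoly roots) (λ k → - (monomial n k - one k)) x ⟩
      eval (suc n) (charPoly roots) x + eval (suc n) (λ k → - (monomial n k - one k)) x
        ≈⟨ +-congˡ (trans (eval-neg (suc n) (λ k → monomial n k - one k) x)
                          (-‿cong (eval-+ (suc n) (monomial n) (λ k → - one k) x))) ⟩
      eval (suc n) (charPoly roots) x - (eval (suc n) (monomial n) x + eval (suc n) (λ k → - one k) x)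
        ≈⟨ +-cong (eval-charPoly roots (suc n) x (ℕP.≤-reflexive (≡.cong suc length-roots)))
                  (-‿cong (+-cong (eval-monomial n (suc n) x ℕP.≤-refl)
                                  (trans (eval-neg (suc n) one x) (-‿cong (eval-one n x))))) ⟩
      Π (map (λ r → x - r) roots) - (x ^ n - 1#) ∎
      where
      difference-n≈0 : difference n ≈ 0#
      difference-n≈0 = begin
        charPoly roots n - (monomial n n - 0#)
          ≈⟨ +-cong (≡.subst (λ k → charPoly roots k ≈ 1#) length-roots (charPoly-monic roots))
                    (-‿cong (+-congʳ (reflexive (monomial-n n)))) ⟩
        1# - (1# - 0#)
          ≈⟨ solve 0 (con (+ 1) :- (con (+ 1) :- con (+ 0)) := con (+ 0)) refl ⟩
        0# ∎

    difference≈0 : ∀ k → k < n → difference k ≈ 0#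
    difference≈0 = eval-roots⇒zero n difference (ζ ^_) ζ^-distinct (λ i i<n → begin
      eval n difference (ζ ^ i)
        ≈⟨ eval-difference (ζ ^ i) ⟩
      Π (map (λ r → ζ ^ i - r) roots) - ((ζ ^ i) ^ n - 1#)
        ≈⟨ +-cong (Π-map-root roots (ζ^-∈-roots i i<n)) (-‿cong (+-congʳ (ζ^-root i))) ⟩
      0# - (1# - 1#)
        ≈⟨ solve 0 (con (+ 0) :- (con (+ 1) :- con (+ 1)) := con (+ 0)) refl ⟩
      0# ∎)

    [x-1]∏[x-ζⁱ] : ∀ x → (x - 1#) * Π (map (λ r → x - r) nontrivialRoots) ≈ x ^ n - 1#
    [x-1]∏[x-ζⁱ] x = begin
      Π (map (λ r → x - r) roots)
        ≈⟨ solve 2 (λ P Q → P := P :- Q :+ Q) refl _ _ ⟩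
      (Π (map (λ r → x - r) roots) - (x ^ n - 1#)) + (x ^ n - 1#)
        ≈⟨ +-congʳ (eval-difference x) ⟨
      eval n difference x + (x ^ n - 1#)
        ≈⟨ +-congʳ (eval-zero n difference x difference≈0) ⟩
      0# + (x ^ n - 1#)
        ≈⟨ +-identityˡ _ ⟩
      x ^ n - 1# ∎

    weight : Carrier → Carrier
    weight z = inv (1# - z) ^ 2

    xs : List Carrier
    xs = map weight nontrivialRoots

    X : Carrier
    X = Π xs

    Zstar≈completeHom-xs : ∀ m → Zstar F n ζ m 2 ≈ completeHom xs m
    Zstar≈completeHom-xs m = trans (Zstar≈completeHom n ζ 2 m)
      (reflexive (≡.cong (λ L → completeHom L m) (LP.map-∘ (range1 n))))

    ∏[1-xs²] : Carrier → Carrier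
    ∏[1-xs²] s = Π (map (λ a → 1# - a * (s * s)) xs)

    binomialSum : Carrier → Carrier
    binomialSum s = (1# - (1# - s) ^ n) + (- ((1# + s) ^ n) + (1# - s * s) ^ n)

    ∏[1-xs²]-factor : ∀ s → ∏[1-xs²] s ≈
      X * (Π (map (λ r → (1# - s) - r) nontrivialRoots) * Π (map (λ r → (1# + s) - r) nontrivialRoots))
    ∏[1-xs²]-factor s = begin
      Π (map (λ a → 1# - a * (s * s)) xs)
        ≡⟨ ≡.cong Π (LP.map-∘ nontrivialRoots) ⟨
      Π (map (λ z → 1# - weight z * (s * s)) nontrivialRoots)
        ≈⟨ Π-map-cong _ _ nontrivialRoots-≉1 (λ {z} → 1-[1-z]⁻²s²-factor z s) ⟩
      Π (map (λ z → weight z * (((1# - s) - z) * ((1# + s) - z))) nontrivialRoots)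
        ≈⟨ Π-map-* weight (λ z → ((1# - s) - z) * ((1# + s) - z)) nontrivialRoots ⟩
      X * Π (map (λ z → ((1# - s) - z) * ((1# + s) - z)) nontrivialRoots)
        ≈⟨ *-congˡ (Π-map-* (λ z → (1# - s) - z) (λ z → (1# + s) - z) nontrivialRoots) ⟩
      X * (Π (map (λ r → (1# - s) - r) nontrivialRoots) * Π (map (λ r → (1# + s) - r) nontrivialRoots)) ∎

    -- s² ∏ (1 - xᵢ s²) = -X ((1 - s)ⁿ - 1) ((1 + s)ⁿ - 1), by [x-1]∏[x-ζⁱ] at x = 1 ± s.
    generating-identity : ∀ s → s * (s * ∏[1-xs²] s) + X * binomialSum s ≈ 0#
    generating-identity s = begin
      s * (s * ∏[1-xs²] s) + X * ((1# - A) + (- B + AB))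
        ≈⟨ +-cong (*-congˡ (*-congˡ (∏[1-xs²]-factor s))) (*-congˡ (+-congˡ (+-congˡ AB≈A*B))) ⟩
      s * (s * (X * (P * Q))) + X * ((1# - A) + (- B + A * B))
        ≈⟨ +-congʳ (solve 4 (λ s X P Q → s :* (s :* (X :* (P :* Q)))
                                      := :- X :* (((con (+ 1) :- s) :- con (+ 1)) :* P :* (((con (+ 1) :+ s) :- con (+ 1)) :* Q)))
                            refl s X P Q) ⟩
      - X * (((1# - s) - 1#) * P * (((1# + s) - 1#) * Q)) + X * ((1# - A) + (- B + A * B))
        ≈⟨ +-congʳ (*-congˡ (*-cong ([x-1]∏[x-ζⁱ] (1# - s)) ([x-1]∏[x-ζⁱ] (1# + s)))) ⟩
      - X * ((A - 1#) * (B - 1#)) + X * ((1# - A) + (- B + A * B))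
        ≈⟨ solve 3 (λ X a b → :- X :* ((a :- con (+ 1)) :* (b :- con (+ 1)))
                              :+ X :* ((con (+ 1) :- a) :+ (:- b :+ a :* b)) := con (+ 0))
                   refl X A B ⟩
      0# ∎
      where
      A  = (1# - s) ^ n
      B  = (1# + s) ^ n
      AB = (1# - s * s) ^ n
      P  = Π (map (λ r → (1# - s) - r) nontrivialRoots)
      Q  = Π (map (λ r → (1# + s) - r) nontrivialRoots)
      AB≈A*B : AB ≈ A * B
      AB≈A*B = trans (^-congˡ n (solve 1 (λ s → con (+ 1) :- s :* s := (con (+ 1) :- s) :* (con (+ 1) :+ s)) refl s))
                     (^-distrib-* _ _ n)

    E : ℕ → Carrier
    E = dualCharPoly xs

    binomialSumCoeff : ℕ → Carrier
    binomialSumCoeff j = (one j - atNeg (binomial n) j) + (- binomial n j + atSquare (atNeg (binomial n)) j)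

    eval-binomialSumCoeff : ∀ K → n ≤ K → ∀ s → eval (double (suc K)) binomialSumCoeff s ≈ binomialSum s
    eval-binomialSumCoeff K n≤K s = begin
      eval M binomialSumCoeff s
        ≈⟨ eval-+ M (λ j → one j - atNeg B j) (λ j → - B j + atSquare (atNeg B) j) s ⟩
      eval M (λ j → one j - atNeg B j) s + eval M (λ j → - B j + atSquare (atNeg B) j) s
        ≈⟨ +-cong (eval-+ M one (λ j → - atNeg B j) s) (eval-+ M (λ j → - B j) (atSquare (atNeg B)) s) ⟩
      (eval M one s + eval M (λ j → - atNeg B j) s) + (eval M (λ j → - B j) s + eval M (atSquare (atNeg B)) s)
        ≈⟨ +-cong (+-cong (eval-one (suc (double K)) s) (trans (eval-neg M (atNeg B) s) (-‿cong B[-s])))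
                  (+-cong (trans (eval-neg M B s) (-‿cong B[s])) B[-s²]) ⟩
      binomialSum s ∎
      where
      M = double (suc K)
      B = binomial n
      n<M : n < M
      n<M = s≤s (ℕP.m≤n⇒m≤1+n (ℕP.≤-trans n≤K (n≤double K)))
      B[s] : eval M B s ≈ (1# + s) ^ n
      B[s] = eval-binomial n M s n<M
      B[-s] : eval M (atNeg B) s ≈ (1# - s) ^ n
      B[-s] = trans (eval-atNeg M B s) (eval-binomial n M (- s) n<M)
      B[-s²] : eval M (atSquare (atNeg B)) s ≈ (1# - s * s) ^ n
      B[-s²] = trans (eval-atSquare (suc K) (atNeg B) s)
                     (trans (eval-atNeg (suc K) B (s * s)) (eval-binomial n (suc K) (- (s * s)) (s≤s n≤K)))

    generatingCoeff : ℕ → Carrier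
    generatingCoeff j = shift (shift (atSquare E)) j + X * binomialSumCoeff j

    eval-generatingCoeff : ∀ K → n ≤ K → ∀ s →
      eval (double (suc K)) generatingCoeff s ≈ s * (s * ∏[1-xs²] s) + X * binomialSum s
    eval-generatingCoeff K n≤K s = begin
      eval M generatingCoeff s
        ≈⟨ eval-+ M (shift (shift (atSquare E))) (λ j → X * binomialSumCoeff j) s ⟩
      eval M (shift (shift (atSquare E))) s + eval M (λ j → X * binomialSumCoeff j) s
        ≈⟨ +-cong s²E[s²] (trans (eval-*ˡ M X binomialSumCoeff s) (*-congˡ (eval-binomialSumCoeff K n≤K s))) ⟩
      s * (s * ∏[1-xs²] s) + X * binomialSum s ∎
      where
      M = double (suc K)
      |xs|<K : length xs < K
      |xs|<K = ≡.subst (_< K) (≡.sym (≡.trans (LP.length-map weight nontrivialRoots) length-nontrivialRoots)) n≤K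
      s²E[s²] : eval M (shift (shift (atSquare E))) s ≈ s * (s * ∏[1-xs²] s)
      s²E[s²] = begin
        eval M (shift (shift (atSquare E))) s             ≈⟨ eval-shift (suc (double K)) (shift (atSquare E)) s ⟩
        s * eval (suc (double K)) (shift (atSquare E)) s  ≈⟨ *-congˡ (eval-shift (double K) (atSquare E) s) ⟩
        s * (s * eval (double K) (atSquare E) s)          ≈⟨ *-congˡ (*-congˡ (eval-atSquare K E s)) ⟩
        s * (s * eval K E (s * s))                        ≈⟨ *-congˡ (*-congˡ (eval-dualCharPoly xs K (s * s) |xs|<K)) ⟩
        s * (s * ∏[1-xs²] s)                              ∎

    generatingCoeff≈0 : ∀ K → n ≤ K → ∀ j → j < double (suc K) → generatingCoeff j ≈ 0#
    generatingCoeff≈0 K n≤K = eval≈0⇒zero (double (suc K)) generatingCoeff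
      (λ i → trans (eval-generatingCoeff K n≤K (ι i)) (generating-identity (ι i)))

    coefficient : ℕ → Carrier
    coefficient k = ι 2 * ι (n C (2 N.* k N.+ 2)) + (- 1#) ^ k * ι (n C (k N.+ 1))

    -- Read off the coefficient of s^(2k+2) in the generating identity.
    E≈X*coefficient : ∀ k → E k ≈ X * coefficient k
    E≈X*coefficient k = begin
      E k
        ≈⟨ solve 5 (λ e x a b σ → e := (e :+ x :* ((con (+ 0) :- a) :+ (:- a :+ (:- con (+ 1) :* σ) :* b)))
                                       :+ x :* ((con (+ 1) :+ (con (+ 1) :+ con (+ 0))) :* a :+ σ :* b))
                   refl (E k) X A₂ A₁ σ ⟩
      (E k + X * ((0# - A₂) + (- A₂ + (- 1# * σ) * A₁))) + X * (ι 2 * A₂ + σ * A₁)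
        ≈⟨ +-cong generatingCoeff[2k+2]≈0 (*-congˡ (reflexive coefficient≡)) ⟩
      0# + X * coefficient k
        ≈⟨ +-identityˡ _ ⟩
      X * coefficient k ∎
      where
      B  = binomial n
      A₂ = B (double (suc k))
      A₁ = B (suc k)
      σ  = (- 1#) ^ k
      coefficient≡ : ι 2 * A₂ + σ * A₁ ≡ coefficient k
      coefficient≡ = ≡.cong₂ (λ a b → ι 2 * ι (n C a) + σ * ι (n C b)) (double-suc k) (ℕP.+-comm 1 k)
      binomialSumCoeff[2k+2] : binomialSumCoeff (double (suc k)) ≈ (0# - A₂) + (- A₂ + (- 1# * σ) * A₁)
      binomialSumCoeff[2k+2] = +-cong (+-congˡ (-‿cong (atNeg-double B (suc k))))
        (+-congˡ (trans (reflexive (atSquare-double (atNeg B) (suc k))) (atNeg-sign B (suc k))))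
      generatingCoeff[2k+2]≈0 : E k + X * ((0# - A₂) + (- A₂ + (- 1# * σ) * A₁)) ≈ 0#
      generatingCoeff[2k+2]≈0 = begin
        E k + X * ((0# - A₂) + (- A₂ + (- 1# * σ) * A₁))
          ≈⟨ +-cong (reflexive (≡.sym (atSquare-double E k))) (*-congˡ (sym binomialSumCoeff[2k+2])) ⟩
        generatingCoeff (double (suc k))
          ≈⟨ generatingCoeff≈0 (n N.+ k) (ℕP.m≤m+n n k) (double (suc k)) (double-mono-< (s≤s (ℕP.m<n+m k (s≤s z≤n)))) ⟩
        0# ∎

    X≈1/n² : X ≈ inv (ι n ^ 2)
    X≈1/n² = begin
      X
        ≈⟨ *-identityʳ X ⟨
      X * 1#
        ≈⟨ *-congˡ (inv-right n² n²≉0) ⟨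
      X * (n² * inv n²)
        ≈⟨ *-assoc _ _ _ ⟨
      (X * n²) * inv n²
        ≈⟨ *-congʳ (trans (*-congˡ (sym coefficient-0)) (trans (sym (E≈X*coefficient 0)) (dualCharPoly-0 xs))) ⟩
      1# * inv n²
        ≈⟨ *-identityˡ _ ⟩
      inv n² ∎
      where
      n² = ι n ^ 2
      ι[n*n]≈n² : ι (n N.* n) ≈ n²
      ι[n*n]≈n² = trans (ι-* n n) (*-congˡ (sym (*-identityʳ _)))
      n²≉0 : ¬ (n² ≈ 0#)
      n²≉0 n²≈0 = char-zero (n′ N.+ n′ N.* n) (trans ι[n*n]≈n² n²≈0)
      coefficient-0 : coefficient 0 ≈ n²
      coefficient-0 = begin
        ι 2 * ι (n C 2) + 1# * ι (n C 1)   ≈⟨ +-cong (sym (ι-* 2 (n C 2))) (*-identityˡ _) ⟩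
        ι (2 N.* (n C 2)) + ι (n C 1)      ≡⟨ ≡.cong (λ j → ι (2 N.* (n C 2)) + ι j) (nC1≡n n) ⟩
        ι (2 N.* (n C 2)) + ι n            ≈⟨ ι-+ (2 N.* (n C 2)) n ⟨
        ι (2 N.* (n C 2) N.+ n)            ≡⟨ ≡.cong ι (2*nC2+n≡n*n n) ⟩
        ι (n N.* n)                        ≈⟨ ι[n*n]≈n² ⟩
        n²                                 ∎

theorem3 : ∀ {c ℓ} (F : CharZeroField c ℓ) → let open CharZeroField F in
    (n : ℕ) → 2 ≤ n →
    (ζ : Carrier) → ζ ^ n ≈ 1# → (∀ i → 1 ≤ i → i < n → ¬ (ζ ^ i ≈ 1#)) →
    (m : ℕ) → 1 ≤ m → m ≤ n / 2 ∸ 1 →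
    Zstar F n ζ m 2 ≈
      - Σ (map (λ j →
               inv (ι n ^ 2)
               * (ι 2 * ι (n C ((2 N.* m) ∸ (2 N.* j) N.+ 2))
                  + (- 1#) ^ (m ∸ j) * ι (n C ((m ∸ j) N.+ 1)))
               * Zstar F n ζ j 2)
             (upTo m))
theorem3 F (suc n′) _ ζ ζⁿ≈1 ζ-primitive (suc m′) _ _ = begin
  Zstar F n ζ m 2                                  ≈⟨ Zstar≈completeHom-xs m ⟩
  completeHom F xs m                               ≈⟨ completeHom-recurrence F xs m′ ⟩
  - Σ< F m (λ j → completeHom F xs j * E (m ∸ j))  ≈⟨ -‿cong (Σ<-cong F m _ term hⱼeₘ₋ⱼ≈term) ⟩
  - Σ< F m term                                    ≡⟨ ≡.cong -_ (Σ-map-applyUpTo F term id m) ⟨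
  - Σ (map term (upTo m))                          ∎
  where
  open CharZeroField F hiding (zero)
  open RootsOfUnity F n′ ζ ζⁿ≈1 ζ-primitive
  open import Relation.Binary.Reasoning.Setoid setoid
  m = suc m′

  term : ℕ → Carrier
  term j = inv (ι n ^ 2)
           * (ι 2 * ι (n C ((2 N.* m) ∸ (2 N.* j) N.+ 2))
              + (- 1#) ^ (m ∸ j) * ι (n C ((m ∸ j) N.+ 1)))
           * Zstar F n ζ j 2

  hⱼeₘ₋ⱼ≈term : ∀ j → completeHom F xs j * E (m ∸ j) ≈ term j
  hⱼeₘ₋ⱼ≈term j = begin
    completeHom F xs j * E (m ∸ j)
      ≈⟨ *-cong (sym (Zstar≈completeHom-xs j)) (E≈X*coefficient (m ∸ j)) ⟩
    Zstar F n ζ j 2 * (X * coefficient (m ∸ j))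
      ≈⟨ *-comm _ _ ⟩
    X * coefficient (m ∸ j) * Zstar F n ζ j 2
      ≈⟨ *-congʳ (*-cong X≈1/n² (reflexive coefficient[m∸j])) ⟩
    term j ∎
    where
    coefficient[m∸j] : coefficient (m ∸ j) ≡
                       ι 2 * ι (n C ((2 N.* m) ∸ (2 N.* j) N.+ 2)) + (- 1#) ^ (m ∸ j) * ι (n C ((m ∸ j) N.+ 1))
    coefficient[m∸j] = ≡.cong (λ k → ι 2 * ι (n C (k N.+ 2)) + (- 1#) ^ (m ∸ j) * ι (n C ((m ∸ j) N.+ 1)))
                              (ℕP.*-distribˡ-∸ 2 m j)
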